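{- The following two statements are equivalent: (A) For every $2$-edge-connected cubic graph $G$ and every non-separating cycle $C$ of $G$, $G$ has a CDC $\mathcal S$ with $C \in \mathcal S$. (B) For every $2$-edge-connected cubic graph $G$ which has a decomposition into a tree $T$ and a cycle $C$, $G$ has a CDC $\mathcal S$ with $C \in \mathcal S$.
   Context: Graphs are finite and may have parallel edges. A cycle is a graph (here a subgraph) in which every vertex has even degree. A subgraph $C$ of a connected graph $H$ is non-separating if $H - E(C)$ is connected. A decomposition of a graph $G$ is a set of edge-disjoint subgraphs whose edge sets cover $E(G)$. A cycle double cover (CDC) of $G$ is a set of cycles of $G$ such that every edge of $G$ lies in the edge sets of exactly two of them. -}

module Defs where

open import Data.Nat using (ℕ; zero; suc; _+_)
open import Data.Nat.Divisibility using (_∣_)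
open import Data.Bool using (Bool; true; false; if_then_else_)
open import Data.Fin using (Fin; zero; suc; _≟_)
open import Data.Fin.Subset using (Subset; _∈_; _∉_; ∁; ⁅_⁆) renaming (⊤ to Full)
open import Data.Vec using (lookup)
open import Data.List using (List; []; _∷_)
open import Data.List.Membership.Propositional using () renaming (_∈_ to _∈ˡ_)
open import Data.List.Relation.Unary.Unique.Propositional using (Unique)
open import Data.Product using (Σ; ∃; _×_; _,_)
open import Data.Sum using (_⊎_)
open import Relation.Nullary using (¬_; does)
open import Relation.Binary.PropositionalEquality using (_≡_)

-- A finite multigraph: vertices Fin n, edges Fin m, each edge e has ends
-- end₁ e and end₂ e (parallel edges allowed; loops allowed, counted twice
-- in degrees).
record Graph : Set where
  field
    n    : ℕ
    m    : ℕ
    end₁ : Fin m → Fin n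
    end₂ : Fin m → Fin n

open Graph public

-- Edge sets of G (subgraphs are identified with their edge sets).
EdgeSet : Graph → Set
EdgeSet G = Subset (m G)

sumFin : (k : ℕ) → (Fin k → ℕ) → ℕ
sumFin zero    f = 0
sumFin (suc k) f = f zero + sumFin k (λ i → f (suc i))

ind : Bool → ℕ
ind true  = 1
ind false = 0

deg : (G : Graph) → EdgeSet G → Fin (n G) → ℕ
deg G F x = sumFin (m G) (λ e →
  if lookup F e
  then ind (does (end₁ G e ≟ x)) + ind (does (end₂ G e ≟ x))
  else 0)

Cubic : Graph → Set
Cubic G = ∀ x → deg G Full x ≡ 3

IsCycle : (G : Graph) → EdgeSet G → Set
IsCycle G F = ∀ x → 2 ∣ deg G F x

data Reach (G : Graph) (F : EdgeSet G) : Fin (n G) → Fin (n G) → Set where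
  here  : ∀ {x} → Reach G F x x
  step₁ : ∀ {y} (e : Fin (m G)) → e ∈ F → Reach G F (end₂ G e) y → Reach G F (end₁ G e) y
  step₂ : ∀ {y} (e : Fin (m G)) → e ∈ F → Reach G F (end₁ G e) y → Reach G F (end₂ G e) y

Connected : (G : Graph) → EdgeSet G → Set
Connected G F = ∀ x y → Reach G F x y

TwoEdgeConnected : Graph → Set
TwoEdgeConnected G = Connected G Full × (∀ e → Connected G (∁ ⁅ e ⁆))

NonSeparating : (G : Graph) → EdgeSet G → Set
NonSeparating G C = Connected G (∁ C)

IsTree : (G : Graph) → Subset (n G) → EdgeSet G → Set
IsTree G V E =
  (∀ e → e ∈ E → end₁ G e ∈ V × end₂ G e ∈ V) ×
  (∃ λ x → x ∈ V) ×
  (∀ x y → x ∈ V → y ∈ V → Reach G E x y) ×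
  (∀ (D : EdgeSet G) → (∀ e → e ∈ D → e ∈ E) → IsCycle G D → ∀ e → e ∉ D)

TreeCycleDecomposition : (G : Graph) → Subset (n G) → EdgeSet G → EdgeSet G → Set
TreeCycleDecomposition G V E C =
  IsTree G V E × IsCycle G C ×
  (∀ e → ¬ (e ∈ E × e ∈ C)) × (∀ e → e ∈ E ⊎ e ∈ C)

count : {G : Graph} → Fin (m G) → List (EdgeSet G) → ℕ
count e []      = 0
count {G} e (D ∷ S) = ind (lookup D e) + count {G} e S

-- cycle double cover: a set (duplicate-free list) of cycles covering each edge exactly twice
IsCDC : (G : Graph) → List (EdgeSet G) → Set
IsCDC G S = Unique S × (∀ (D : EdgeSet G) → D ∈ˡ S → IsCycle G D) × (∀ e → count {G} e S ≡ 2)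

HasCDCContaining : (G : Graph) → EdgeSet G → Set
HasCDCContaining G C = Σ (List (EdgeSet G)) λ S → IsCDC G S × C ∈ˡ S

StatementA : Set
StatementA = (G : Graph) → TwoEdgeConnected G → Cubic G →
  (C : EdgeSet G) → IsCycle G C → NonSeparating G C → HasCDCContaining G C

StatementB : Set
StatementB = (G : Graph) → TwoEdgeConnected G → Cubic G →
  (V : Subset (n G)) (T C : EdgeSet G) → TreeCycleDecomposition G V T C →
  HasCDCContaining G C

-- (A) ⇒ (B): a vertex of a cubic graph has odd degree outside any cycle C, so it meets an edge of the
-- tree complementary to C; that tree therefore spans G, and G − E(C) is connected.
--
-- (B) ⇒ (A): take a spanning tree T of G − E(C).  While some edge r = uv lies neither in C nor in T,
-- replace it by a path u α β v whose middle edge is doubled, add the digon to C and the edges uα, βv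
-- to T.  The new graph is again cubic and 2-edge-connected, with one such edge fewer, so eventually
-- (B) applies.  Deleting α and β maps its cycle double cover to a cover of G by a list of cycles
-- containing C: parity at α and β forces a cycle to use βv exactly when it uses uα.  Finally a
-- repeated cycle Y is merged with a further member W of the list, which is disjoint from Y because
-- the two copies of Y already cover Y twice; this shortens the list until no cycle repeats.

module Submission where

open import Defs
open import Function.Bundles using (_⇔_; mk⇔)
open import Function.Base using (_∘_; case_of_)
open import Data.Nat using (ℕ; zero; suc; _+_; _≤_; _<_; z≤n; s≤s)
open import Data.Nat.Properties
  using (+-identityʳ; +-assoc; +-comm; +-cancelˡ-≡; +-commutativeSemigroup; +-suc; +-monoˡ-≤; +-mono-≤;
         ≤-refl; ≤-reflexive; ≤-trans; ≤-pred; <-irrefl; m≤n+m; m≤n⇒m≤1+n; <-≤-trans; ≤-<-trans)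
open import Algebra.Properties.CommutativeSemigroup +-commutativeSemigroup
  using (interchange; xy∙z≈zy∙x; x∙yz≈z∙xy; x∙yz≈y∙xz)
open import Data.Nat.Divisibility using (_∣_; divides; ∣m∣n⇒∣m+n)
import Data.Bool
open import Data.Bool using (Bool; true; false; if_then_else_; not; _∨_)
open import Data.Fin using (Fin; zero; suc; _≟_)
open import Data.Fin.Properties using (any?; suc-injective)
open import Data.Fin.Subset using (Subset; _∈_; _∉_; ∁; ⁅_⁆; _∪_; _⊆_; _⊂_; ∣_∣) renaming (⊤ to Full; ⊥ to Empty)
open import Data.Fin.Subset.Properties
  using (nonempty?; ∈⊤; ∉⊥; x∈⁅x⁆; x∈⁅y⁆⇒x≡y; x∈∁p⇒x∉p; x∉p⇒x∈∁p; x∉∁p⇒x∈p; ⊆-antisym;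
         x∈p∪q⁻; x∈p∪q⁺; _∈?_; p⊂q⇒∣p∣<∣q∣; p⊂q⇒∁p⊃∁q; ∣p∣≤n)
open import Data.Vec using (lookup; _∷_; here; there)
open import Data.Vec.Properties using (≡-dec; []=⇒lookup; lookup⇒[]=; lookup-map; lookup-zipWith)
open import Data.List using (List; []; _∷_; _++_; length; map)
open import Data.List.Membership.Propositional using () renaming (_∈_ to _∈ˡ_)
open import Data.List.Membership.Propositional.Properties using (∈-map⁺; ∈-map⁻; ∈-∃++)
open import Data.List.Relation.Binary.Permutation.Propositional as Perm using (_↭_; prep; swap)
open import Data.List.Relation.Binary.Permutation.Propositional.Properties using (∈-resp-↭; ↭-length; shift)
import Data.List.Relation.Unary.Any as Any
open import Data.List.Relation.Unary.All using ([])
open import Data.List.Relation.Unary.All.Properties using (¬Any⇒All¬)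
open import Data.List.Relation.Unary.AllPairs using ([]; _∷_)
open import Data.List.Relation.Unary.Unique.Propositional using (Unique)
open import Data.Product using (Σ; ∃; ∃₂; _×_; _,_; proj₁; proj₂)
open import Data.Sum using (_⊎_; inj₁; inj₂)
open import Data.Empty using (⊥; ⊥-elim)
open import Relation.Nullary using (¬_; does; yes; no)
open import Relation.Nullary.Decidable using (dec-true; dec-false)
open import Relation.Binary.PropositionalEquality using (_≡_; _≢_; refl; sym; trans; cong; cong₂; subst; module ≡-Reasoning)

sumFin-cong : ∀ k {f g : Fin k → ℕ} → (∀ i → f i ≡ g i) → sumFin k f ≡ sumFin k g
sumFin-cong zero    eq = refl
sumFin-cong (suc k) eq = cong₂ _+_ (eq zero) (sumFin-cong k (eq ∘ suc))

sumFin-+ : ∀ k (f g : Fin k → ℕ) → sumFin k (λ i → f i + g i) ≡ sumFin k f + sumFin k g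
sumFin-+ zero    f g = refl
sumFin-+ (suc k) f g =
  trans (cong (f zero + g zero +_) (sumFin-+ k (f ∘ suc) (g ∘ suc)))
        (interchange (f zero) (g zero) _ _)

sumFin-zero : ∀ k (f : Fin k → ℕ) → (∀ i → f i ≡ 0) → sumFin k f ≡ 0
sumFin-zero zero    f eq = refl
sumFin-zero (suc k) f eq rewrite eq zero = sumFin-zero k (f ∘ suc) (eq ∘ suc)

sumFin-single : ∀ k (f : Fin k → ℕ) r → (∀ i → i ≢ r → f i ≡ 0) → sumFin k f ≡ f r
sumFin-single (suc k) f zero eq =
  trans (cong (f zero +_) (sumFin-zero k (f ∘ suc) (λ i → eq (suc i) λ ()))) (+-identityʳ _)
sumFin-single (suc k) f (suc r) eq rewrite eq zero λ () =
  sumFin-single k (f ∘ suc) r (λ i i≢r → eq (suc i) (i≢r ∘ suc-injective))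

sumFin-update : ∀ k (f g : Fin k → ℕ) r → (∀ i → i ≢ r → f i ≡ g i) →
                sumFin k f + g r ≡ sumFin k g + f r
sumFin-update (suc k) f g zero eq
  rewrite sumFin-cong k {f ∘ suc} {g ∘ suc} (λ i → eq (suc i) λ ()) = xy∙z≈zy∙x (f zero) _ (g zero)
sumFin-update (suc k) f g (suc r) eq rewrite eq zero λ () =
  trans (+-assoc (g zero) _ (g (suc r)))
    (trans (cong (g zero +_) (sumFin-update k (f ∘ suc) (g ∘ suc) r (λ i i≢r → eq (suc i) (i≢r ∘ suc-injective))))
           (sym (+-assoc (g zero) _ (f (suc r)))))

sumFin-pos : ∀ k (f : Fin k → ℕ) → 1 ≤ sumFin k f → ∃ λ i → 1 ≤ f i
sumFin-pos (suc k) f pos with f zero in eq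
... | suc _ = zero , subst (1 ≤_) (sym eq) (s≤s z≤n)
... | zero  with sumFin-pos k (f ∘ suc) pos
...   | i , fi = suc i , fi

∈⇒lookup : ∀ {k} {p : Subset k} {x} → x ∈ p → lookup p x ≡ true
∈⇒lookup = []=⇒lookup

lookup⇒∈ : ∀ {k} {p : Subset k} {x} → lookup p x ≡ true → x ∈ p
lookup⇒∈ {p = p} {x} = lookup⇒[]= x p

∉⇒lookup : ∀ {k} {p : Subset k} {x} → x ∉ p → lookup p x ≡ false
∉⇒lookup {p = p} {x} x∉p with lookup p x in eq
... | true  = ⊥-elim (x∉p (lookup⇒∈ eq))
... | false = refl

lookup-∁ : ∀ {k} (p : Subset k) x → lookup (∁ p) x ≡ not (lookup p x)
lookup-∁ p x = lookup-map x not p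

lookup-∪ : ∀ {k} (p q : Subset k) x → lookup (p ∪ q) x ≡ lookup p x ∨ lookup q x
lookup-∪ p q x = lookup-zipWith _∨_ x p q

ind-≡ : ∀ {k} {x y : Fin k} → x ≡ y → ind (does (x ≟ y)) ≡ 1
ind-≡ {x = x} {y} eq rewrite dec-true (x ≟ y) eq = refl

ind-≢ : ∀ {k} {x y : Fin k} → x ≢ y → ind (does (x ≟ y)) ≡ 0
ind-≢ {x = x} {y} x≢y rewrite dec-false (x ≟ y) x≢y = refl

ind-pos : ∀ {k} (x y : Fin k) → 1 ≤ ind (does (x ≟ y)) → x ≡ y
ind-pos x y pos with x ≟ y
... | yes x≡y = x≡y

ind-∨ : ∀ a b → (a ≡ true → b ≡ false) → ind (a ∨ b) ≡ ind a + ind b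
ind-∨ true  b disjoint rewrite disjoint refl = refl
ind-∨ false b disjoint = refl

¬2∣1 : ¬ (2 ∣ 1)
¬2∣1 (divides zero    ())
¬2∣1 (divides (suc q) ())

¬2∣3 : ¬ (2 ∣ 3)
¬2∣3 (divides (suc zero)    ())
¬2∣3 (divides (suc (suc q)) ())

incidence : (G : Graph) → Fin (m G) → Fin (n G) → ℕ
incidence G e x = ind (does (end₁ G e ≟ x)) + ind (does (end₂ G e ≟ x))

select : Bool → ℕ → ℕ
select b c = if b then c else 0

select-0 : ∀ b → select b 0 ≡ 0
select-0 true  = refl
select-0 false = refl

ind-select : ∀ b → select b 1 ≡ ind b
ind-select true  = refl
ind-select false = refl

deg-∁ : ∀ G (F : EdgeSet G) x → deg G F x + deg G (∁ F) x ≡ deg G Full x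
deg-∁ G F x = trans (sym (sumFin-+ (m G) _ _)) (sumFin-cong (m G) term)
  where
  term : ∀ e → select (lookup F e) (incidence G e x) + select (lookup (∁ F) e) (incidence G e x)
             ≡ select (lookup Full e) (incidence G e x)
  term e rewrite lookup-∁ F e | []=⇒lookup (∈⊤ {x = e}) with lookup F e
  ... | true  = +-identityʳ _
  ... | false = refl

deg-∪ : ∀ G (X W : EdgeSet G) x → (∀ e → lookup X e ≡ true → lookup W e ≡ false) →
        deg G (X ∪ W) x ≡ deg G X x + deg G W x
deg-∪ G X W x disjoint = trans (sumFin-cong (m G) term) (sumFin-+ (m G) _ _)
  where
  term : ∀ e → select (lookup (X ∪ W) e) (incidence G e x)
             ≡ select (lookup X e) (incidence G e x) + select (lookup W e) (incidence G e x)
  term e rewrite lookup-∪ X W e with lookup X e in eq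
  ... | true  rewrite disjoint e eq = sym (+-identityʳ _)
  ... | false = refl

deg-pos : ∀ G (F : EdgeSet G) x → 1 ≤ deg G F x →
          ∃ λ e → e ∈ F × (end₁ G e ≡ x ⊎ end₂ G e ≡ x)
deg-pos G F x pos with sumFin-pos (m G) _ pos
... | e , term with lookup F e in e∈F
...   | true with ind (does (end₁ G e ≟ x)) in at₁
...     | suc _ = e , lookup⇒∈ e∈F , inj₁ (ind-pos _ _ (subst (1 ≤_) (sym at₁) (s≤s z≤n)))
...     | zero  = e , lookup⇒∈ e∈F , inj₂ (ind-pos _ _ term)

-- The complement of a cycle of a cubic graph has odd, hence positive, degree everywhere.
cubic-∁cycle-incident : ∀ G → Cubic G → (C : EdgeSet G) → IsCycle G C →
                        ∀ x → ∃ λ e → e ∉ C × (end₁ G e ≡ x ⊎ end₂ G e ≡ x)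
cubic-∁cycle-incident G cubic C cycle x with deg G (∁ C) x in eq
... | suc _ with deg-pos G (∁ C) x (subst (1 ≤_) (sym eq) (s≤s z≤n))
...   | e , e∈∁C , incident = e , x∈∁p⇒x∉p e∈∁C , incident
cubic-∁cycle-incident G cubic C cycle x | zero =
  ⊥-elim (¬2∣3 (subst (2 ∣_) deg≡3 (cycle x)))
  where
  deg≡3 : deg G C x ≡ 3
  deg≡3 = trans (sym (+-identityʳ _)) (trans (cong (deg G C x +_) (sym eq)) (trans (deg-∁ G C x) (cubic x)))

Reach-mono : ∀ {G} {F F′ : EdgeSet G} → F ⊆ F′ → ∀ {x y} → Reach G F x y → Reach G F′ x y
Reach-mono F⊆F′ here          = here
Reach-mono F⊆F′ (step₁ e p r) = step₁ e (F⊆F′ p) (Reach-mono F⊆F′ r)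
Reach-mono F⊆F′ (step₂ e p r) = step₂ e (F⊆F′ p) (Reach-mono F⊆F′ r)

Reach-trans : ∀ {G} {F : EdgeSet G} {x y z} → Reach G F x y → Reach G F y z → Reach G F x z
Reach-trans here          q = q
Reach-trans (step₁ e p r) q = step₁ e p (Reach-trans r q)
Reach-trans (step₂ e p r) q = step₂ e p (Reach-trans r q)

Reach-sym : ∀ {G} {F : EdgeSet G} {x y} → Reach G F x y → Reach G F y x
Reach-sym here          = here
Reach-sym (step₁ e p r) = Reach-trans (Reach-sym r) (step₂ e p here)
Reach-sym (step₂ e p r) = Reach-trans (Reach-sym r) (step₁ e p here)

-- (A) ⇒ (B)

tree-spans : ∀ G → Cubic G → ∀ {V T C} → TreeCycleDecomposition G V T C → ∀ x → x ∈ V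
tree-spans G cubic ((ends , _) , cycle , _ , cover) x with cubic-∁cycle-incident G cubic _ cycle x
... | e , e∉C , incident with cover e
...   | inj₂ e∈C = ⊥-elim (e∉C e∈C)
...   | inj₁ e∈T with incident
...     | inj₁ refl = proj₁ (ends e e∈T)
...     | inj₂ refl = proj₂ (ends e e∈T)

tree-cycle⇒nonSeparating : ∀ G → Cubic G → ∀ {V T C} → TreeCycleDecomposition G V T C → NonSeparating G C
tree-cycle⇒nonSeparating G cubic dec@((_ , _ , connected , _) , _ , disjoint , _) x y =
  Reach-mono (λ e∈T → x∉p⇒x∈∁p (λ e∈C → disjoint _ (e∈T , e∈C)))
             (connected x y (tree-spans G cubic dec x) (tree-spans G cubic dec y))

A⇒B : StatementA → StatementB
A⇒B hA G 2ec cubic V T C dec@(_ , cycle , _) =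
  hA G 2ec cubic C cycle (tree-cycle⇒nonSeparating G cubic dec)

-- Ranked spanning trees

if-≟-yes : ∀ {k} {A : Set} {x y : Fin k} (a b : A) → x ≡ y → (if does (x ≟ y) then a else b) ≡ a
if-≟-yes {x = x} {y} a b eq rewrite dec-true (x ≟ y) eq = refl

if-≟-no : ∀ {k} {A : Set} {x y : Fin k} (a b : A) → x ≢ y → (if does (x ≟ y) then a else b) ≡ b
if-≟-no {x = x} {y} a b x≢y rewrite dec-false (x ≟ y) x≢y = refl

∈-∪⁅⁆ˡ : ∀ {k} {p : Subset k} {w x} → x ∈ p → x ∈ p ∪ ⁅ w ⁆
∈-∪⁅⁆ˡ x∈p = x∈p∪q⁺ (inj₁ x∈p)

∈-∪⁅⁆ʳ : ∀ {k} {p : Subset k} w → w ∈ p ∪ ⁅ w ⁆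
∈-∪⁅⁆ʳ w = x∈p∪q⁺ (inj₂ (x∈⁅x⁆ w))

∈-∪⁅⁆⁻ : ∀ {k} (p : Subset k) w {x} → x ∈ p ∪ ⁅ w ⁆ → x ∈ p ⊎ x ≡ w
∈-∪⁅⁆⁻ p w x∈ with x∈p∪q⁻ p ⁅ w ⁆ x∈
... | inj₁ x∈p = inj₁ x∈p
... | inj₂ x∈w = inj₂ (x∈⁅y⁆⇒x≡y w x∈w)

∈∁⁅⁆ : ∀ {k} {e : Fin k} e′ → e ≢ e′ → e ∈ ∁ ⁅ e′ ⁆
∈∁⁅⁆ e′ e≢e′ = x∉p⇒x∈∁p (e≢e′ ∘ x∈⁅y⁆⇒x≡y e′)

∈∁⁅⁆⁻ : ∀ {k} {e e′ : Fin k} → e ∈ ∁ ⁅ e′ ⁆ → e ≢ e′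
∈∁⁅⁆⁻ {e = e} e∈ refl = x∈∁p⇒x∉p e∈ (x∈⁅x⁆ e)

ChildEnd : (G : Graph) → (Fin (n G) → ℕ) → Fin (m G) → Fin (n G) → Set
ChildEnd G rank e c = (end₁ G e ≡ c × rank (end₂ G e) < rank c) ⊎ (end₂ G e ≡ c × rank (end₁ G e) < rank c)

record RankedTree (G : Graph) (S : Subset (n G)) : Set where
  field
    root            : Fin (n G)
    root∈           : root ∈ S
    edges           : EdgeSet G
    rank            : Fin (n G) → ℕ
    bound           : ℕ
    rank<bound      : ∀ x → rank x < bound
    child           : Fin (m G) → Fin (n G)
    childEnd        : ∀ {e} → e ∈ edges → ChildEnd G rank e (child e)
    child-injective : ∀ {e e′} → e ∈ edges → e′ ∈ edges → child e ≡ child e′ → e ≡ e′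
    parent          : ∀ {x} → x ∈ S → x ≢ root → ∃ λ e → e ∈ edges × child e ≡ x
    ends∈           : ∀ {e} → e ∈ edges → end₁ G e ∈ S × end₂ G e ∈ S

module _ {G : Graph} (P : RankedTree G Full) where
  open RankedTree P

  reach-root : ∀ k x → rank x < k → Reach G edges x root
  reach-root (suc k) x rx<k with x ≟ root
  ... | yes refl = here
  ... | no x≢root with parent ∈⊤ x≢root
  ...   | e , e∈T , refl with childEnd e∈T
  ...     | inj₁ (eq , lt) = subst (λ z → Reach G edges z root) eq
                               (step₁ e e∈T (reach-root k _ (≤-trans lt (≤-pred rx<k))))
  ...     | inj₂ (eq , lt) = subst (λ z → Reach G edges z root) eq
                               (step₂ e e∈T (reach-root k _ (≤-trans lt (≤-pred rx<k))))

  incidence-child : ∀ {e} → e ∈ edges → incidence G e (child e) ≡ 1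
  incidence-child {e} e∈T with childEnd e∈T
  ... | inj₁ (eq , lt) rewrite ind-≡ eq | ind-≢ (λ q → <-irrefl (cong rank q) lt) = refl
  ... | inj₂ (eq , lt) rewrite ind-≡ eq | ind-≢ (λ q → <-irrefl (cong rank q) lt) = refl

  -- The child of an edge of D of maximal rank would have degree 1 in D.
  ranked-acyclic : (D : EdgeSet G) → D ⊆ edges → IsCycle G D → ∀ e → e ∉ D
  ranked-acyclic D D⊆T cycle e e∈D = above bound e∈D (m≤n+m bound _)
    where
    above : ∀ k {e} → e ∈ D → bound ≤ rank (child e) + k → ⊥
    above zero {e} e∈D le = <-irrefl refl (<-≤-trans (rank<bound (child e)) (subst (bound ≤_) (+-identityʳ _) le))
    above (suc k) {e} e∈D le = ¬2∣1 (subst (2 ∣_) deg≡1 (cycle x))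
      where
      x = child e
      apart : ∀ {e′} → e′ ∈ D → e′ ≢ e → end₁ G e′ ≢ x × end₂ G e′ ≢ x
      apart {e′} e′∈D e′≢e = apart₁ , apart₂
        where
        higher : rank x < rank (child e′) → ⊥
        higher lt = above k e′∈D (≤-trans le (subst (_≤ rank (child e′) + k) (sym (+-suc (rank x) k)) (+-monoˡ-≤ k lt)))
        apart₁ : end₁ G e′ ≢ x
        apart₁ eq with childEnd (D⊆T e′∈D)
        ... | inj₁ (eq′ , _) = e′≢e (child-injective (D⊆T e′∈D) (D⊆T e∈D) (trans (sym eq′) eq))
        ... | inj₂ (_ , lt)  = higher (subst (λ z → rank z < rank (child e′)) eq lt)
        apart₂ : end₂ G e′ ≢ x
        apart₂ eq with childEnd (D⊆T e′∈D)
        ... | inj₂ (eq′ , _) = e′≢e (child-injective (D⊆T e′∈D) (D⊆T e∈D) (trans (sym eq′) eq))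
        ... | inj₁ (_ , lt)  = higher (subst (λ z → rank z < rank (child e′)) eq lt)
      others : ∀ e′ → e′ ≢ e → select (lookup D e′) (incidence G e′ x) ≡ 0
      others e′ e′≢e with lookup D e′ in e′∈D
      ... | false = refl
      ... | true with apart (lookup⇒∈ e′∈D) e′≢e
      ...   | apart₁ , apart₂ rewrite ind-≢ apart₁ | ind-≢ apart₂ = refl
      deg≡1 : deg G D x ≡ 1
      deg≡1 = trans (sumFin-single (m G) _ e others)
                    (subst (λ b → select b (incidence G e x) ≡ 1) (sym (∈⇒lookup e∈D)) (incidence-child (D⊆T e∈D)))

  rankedTree-isTree : IsTree G Full edges
  rankedTree-isTree =
    (λ _ _ → ∈⊤ , ∈⊤) , (root , ∈⊤) ,
    (λ x y _ _ → Reach-trans (reach-root _ x (rank<bound x)) (Reach-sym (reach-root _ y (rank<bound y)))) ,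
    (λ D D⊆T → ranked-acyclic D (λ {e} → D⊆T e))

Joins : (G : Graph) → Fin (m G) → Fin (n G) → Fin (n G) → Set
Joins G e v w = (end₁ G e ≡ v × end₂ G e ≡ w) ⊎ (end₁ G e ≡ w × end₂ G e ≡ v)

crossing-edge : ∀ G {F : EdgeSet G} (S : Subset (n G)) {y x} → Reach G F y x → y ∈ S → x ∉ S →
                ∃ λ e → e ∈ F × ∃₂ λ v w → Joins G e v w × v ∈ S × w ∉ S
crossing-edge G S here y∈S y∉S = ⊥-elim (y∉S y∈S)
crossing-edge G S (step₁ e e∈F r) y∈S x∉S with end₂ G e ∈? S
... | yes z∈S = crossing-edge G S r z∈S x∉S
... | no  z∉S = e , e∈F , _ , _ , inj₁ (refl , refl) , y∈S , z∉S
crossing-edge G S (step₂ e e∈F r) y∈S x∉S with end₁ G e ∈? S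
... | yes z∈S = crossing-edge G S r z∈S x∉S
... | no  z∉S = e , e∈F , _ , _ , inj₂ (refl , refl) , y∈S , z∉S

module Extend {G : Graph} {S : Subset (n G)} (P : RankedTree G S)
              {e : Fin (m G)} {v w : Fin (n G)} (joins : Joins G e v w) (v∈S : v ∈ S) (w∉S : w ∉ S) where
  open RankedTree P

  ≢w : ∀ {x} → x ∈ S → x ≢ w
  ≢w x∈S refl = w∉S x∈S

  e∉T : e ∉ edges
  e∉T e∈T = outside joins
    where
    outside : Joins G e v w → ⊥
    outside (inj₁ (_ , eq)) = ≢w (proj₂ (ends∈ e∈T)) eq
    outside (inj₂ (eq , _)) = ≢w (proj₁ (ends∈ e∈T)) eq

  ≢e : ∀ {e′} → e′ ∈ edges → e′ ≢ e
  ≢e e′∈T refl = e∉T e′∈T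

  rank′ : Fin (n G) → ℕ
  rank′ x = if does (x ≟ w) then suc (rank v) else rank x

  child′ : Fin (m G) → Fin (n G)
  child′ e′ = if does (e′ ≟ e) then w else child e′

  rank′-old : ∀ {x} → x ∈ S → rank′ x ≡ rank x
  rank′-old x∈S = if-≟-no _ _ (≢w x∈S)

  child′-old : ∀ {e′} → e′ ∈ edges → child′ e′ ≡ child e′
  child′-old e′∈T = if-≟-no _ _ (≢e e′∈T)

  child′-new : child′ e ≡ w
  child′-new = if-≟-yes {x = e} w (child e) refl

  child∈S : ∀ {e′} → e′ ∈ edges → child e′ ∈ S
  child∈S e′∈T with childEnd e′∈T
  ... | inj₁ (eq , _) = subst (_∈ S) eq (proj₁ (ends∈ e′∈T))
  ... | inj₂ (eq , _) = subst (_∈ S) eq (proj₂ (ends∈ e′∈T))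

  rank′<bound : ∀ x → rank′ x < suc bound
  rank′<bound x with does (x ≟ w)
  ... | true  = s≤s (rank<bound v)
  ... | false = m≤n⇒m≤1+n (rank<bound x)

  childEnd-new : Joins G e v w → ChildEnd G rank′ e (child′ e)
  childEnd-new j rewrite child′-new | if-≟-yes {x = w} (suc (rank v)) (rank w) refl with j
  ... | inj₁ (eq₁ , eq₂) = inj₂ (eq₂ , subst (λ z → rank′ z < suc (rank v)) (sym eq₁) v-below)
    where v-below = s≤s (≤-reflexive (rank′-old v∈S))
  ... | inj₂ (eq₁ , eq₂) = inj₁ (eq₁ , subst (λ z → rank′ z < suc (rank v)) (sym eq₂) v-below)
    where v-below = s≤s (≤-reflexive (rank′-old v∈S))

  childEnd′ : ∀ {e′} → e′ ∈ edges ∪ ⁅ e ⁆ → ChildEnd G rank′ e′ (child′ e′)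
  childEnd′ {e′} e′∈T′ with ∈-∪⁅⁆⁻ edges e e′∈T′
  ... | inj₂ refl = childEnd-new joins
  ... | inj₁ e′∈T rewrite child′-old e′∈T | rank′-old (child∈S e′∈T) with childEnd e′∈T
  ...   | inj₁ (eq , lt) = inj₁ (eq , subst (_< rank (child e′)) (sym (rank′-old (proj₂ (ends∈ e′∈T)))) lt)
  ...   | inj₂ (eq , lt) = inj₂ (eq , subst (_< rank (child e′)) (sym (rank′-old (proj₁ (ends∈ e′∈T)))) lt)

  child′-injective : ∀ {e₁ e₂} → e₁ ∈ edges ∪ ⁅ e ⁆ → e₂ ∈ edges ∪ ⁅ e ⁆ →
                     child′ e₁ ≡ child′ e₂ → e₁ ≡ e₂
  child′-injective e₁∈ e₂∈ eq with ∈-∪⁅⁆⁻ edges e e₁∈ | ∈-∪⁅⁆⁻ edges e e₂∈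
  ... | inj₂ refl | inj₂ refl = refl
  ... | inj₂ refl | inj₁ e₂∈T =
    ⊥-elim (≢w (child∈S e₂∈T) (trans (sym (child′-old e₂∈T)) (trans (sym eq) child′-new)))
  ... | inj₁ e₁∈T | inj₂ refl =
    ⊥-elim (≢w (child∈S e₁∈T) (trans (sym (child′-old e₁∈T)) (trans eq child′-new)))
  ... | inj₁ e₁∈T | inj₁ e₂∈T =
    child-injective e₁∈T e₂∈T (trans (sym (child′-old e₁∈T)) (trans eq (child′-old e₂∈T)))

  parent′ : ∀ {x} → x ∈ S ∪ ⁅ w ⁆ → x ≢ root → ∃ λ e′ → e′ ∈ edges ∪ ⁅ e ⁆ × child′ e′ ≡ x
  parent′ x∈S′ x≢root with ∈-∪⁅⁆⁻ S w x∈S′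
  ... | inj₂ refl = e , ∈-∪⁅⁆ʳ e , child′-new
  ... | inj₁ x∈S with parent x∈S x≢root
  ...   | e′ , e′∈T , refl = e′ , ∈-∪⁅⁆ˡ e′∈T , child′-old e′∈T

  ends∈′ : ∀ {e′} → e′ ∈ edges ∪ ⁅ e ⁆ → end₁ G e′ ∈ S ∪ ⁅ w ⁆ × end₂ G e′ ∈ S ∪ ⁅ w ⁆
  ends∈′ e′∈T′ with ∈-∪⁅⁆⁻ edges e e′∈T′
  ... | inj₁ e′∈T = ∈-∪⁅⁆ˡ (proj₁ (ends∈ e′∈T)) , ∈-∪⁅⁆ˡ (proj₂ (ends∈ e′∈T))
  ... | inj₂ refl = ends-new joins
    where
    ends-new : Joins G e v w → end₁ G e ∈ S ∪ ⁅ w ⁆ × end₂ G e ∈ S ∪ ⁅ w ⁆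
    ends-new (inj₁ (refl , refl)) = ∈-∪⁅⁆ˡ v∈S , ∈-∪⁅⁆ʳ w
    ends-new (inj₂ (refl , refl)) = ∈-∪⁅⁆ʳ w , ∈-∪⁅⁆ˡ v∈S

  extended : RankedTree G (S ∪ ⁅ w ⁆)
  extended = record
    { root = root ; root∈ = ∈-∪⁅⁆ˡ root∈ ; edges = edges ∪ ⁅ e ⁆ ; rank = rank′ ; bound = suc bound
    ; rank<bound = rank′<bound ; child = child′ ; childEnd = childEnd′ ; child-injective = child′-injective
    ; parent = parent′ ; ends∈ = ends∈′ }

module _ {G : Graph} {F : EdgeSet G} (connected : Connected G F) where
  open RankedTree

  singleton-tree : (r : Fin (n G)) → RankedTree G ⁅ r ⁆
  singleton-tree r = record
    { root = r ; root∈ = x∈⁅x⁆ r ; edges = Empty ; rank = λ _ → 0 ; bound = 1 ; rank<bound = λ _ → s≤s z≤n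
    ; child = λ _ → r ; childEnd = ⊥-elim ∘ ∉⊥ ; child-injective = λ e∈⊥ → ⊥-elim (∉⊥ e∈⊥)
    ; parent = λ x∈r x≢r → ⊥-elim (x≢r (x∈⁅y⁆⇒x≡y r x∈r)) ; ends∈ = ⊥-elim ∘ ∉⊥ }

  grow : ∀ k {S} → n G ≤ ∣ S ∣ + k → (P : RankedTree G S) → edges P ⊆ F →
         Σ (RankedTree G Full) λ P → edges P ⊆ F
  grow k {S} size P T⊆F with any? (λ x → x ∈? ∁ S)
  ... | no none = subst (λ S → Σ (RankedTree G S) λ P → edges P ⊆ F) S≡Full (P , T⊆F)
    where
    S≡Full : S ≡ Full
    S≡Full = ⊆-antisym (λ _ → ∈⊤) (λ {x} _ → x∉∁p⇒x∈p (λ x∈∁S → none (x , x∈∁S)))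
  ... | yes (x , x∈∁S) with crossing-edge G S (connected (root P) x) (root∈ P) (x∈∁p⇒x∉p x∈∁S)
  ...   | e , e∈F , v , w , joins , v∈S , w∉S = continue k size
    where
    larger : ∣ S ∣ < ∣ S ∪ ⁅ w ⁆ ∣
    larger = p⊂q⇒∣p∣<∣q∣ (∈-∪⁅⁆ˡ , w , ∈-∪⁅⁆ʳ w , w∉S)
    continue : ∀ k → n G ≤ ∣ S ∣ + k → Σ (RankedTree G Full) λ P → edges P ⊆ F
    continue zero size =
      ⊥-elim (<-irrefl refl (<-≤-trans (≤-<-trans (subst (n G ≤_) (+-identityʳ _) size) larger) (∣p∣≤n (S ∪ ⁅ w ⁆))))
    continue (suc k) size = grow k size′ (Extend.extended P joins v∈S w∉S) T′⊆F
      where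
      size′ : n G ≤ ∣ S ∪ ⁅ w ⁆ ∣ + k
      size′ = ≤-trans size (≤-trans (≤-reflexive (+-suc _ k)) (+-monoˡ-≤ k larger))
      T′⊆F : edges P ∪ ⁅ e ⁆ ⊆ F
      T′⊆F e′∈T′ with ∈-∪⁅⁆⁻ (edges P) e e′∈T′
      ... | inj₁ e′∈T = T⊆F e′∈T
      ... | inj₂ refl = e∈F

  spanning-tree : Fin (n G) → Σ (RankedTree G Full) λ P → edges P ⊆ F
  spanning-tree r = grow (n G) (m≤n+m _ _) (singleton-tree r) (⊥-elim ∘ ∉⊥)

-- Replacing an edge by a path with a doubled middle edge

IsMultiCDC : (G : Graph) → List (EdgeSet G) → Set
IsMultiCDC G S = (∀ D → D ∈ˡ S → IsCycle G D) × (∀ e → count {G} e S ≡ 2)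

HasMultiCDCContaining : (G : Graph) → EdgeSet G → Set
HasMultiCDCContaining G C = Σ (List (EdgeSet G)) λ S → IsMultiCDC G S × C ∈ˡ S

cancel-middle : ∀ s u v d → s + (u + v) ≡ d + (u + 0) → v + s ≡ d
cancel-middle s u v d eq = +-cancelˡ-≡ u (v + s) d (begin
  u + (v + s)  ≡⟨ x∙yz≈z∙xy u v s ⟩
  s + (u + v)  ≡⟨ eq ⟩
  d + (u + 0)  ≡⟨ cong (d +_) (+-identityʳ u) ⟩
  d + u        ≡⟨ +-comm d u ⟩
  u + d        ∎)
  where open ≡-Reasoning

-- Parity at α and at β: a cycle of the new graph uses βv exactly when it uses the old edge r.
digon-parity : ∀ z₀ z₁ z₂ w → 2 ∣ ind z₁ + (ind z₂ + ind w) → 2 ∣ ind z₀ + (ind z₁ + ind z₂) → z₀ ≡ w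
digon-parity false _     _     false _   _   = refl
digon-parity true  _     _     true  _   _   = refl
digon-parity false true  true  true  odd _   = ⊥-elim (¬2∣3 odd)
digon-parity false true  false true  _   odd = ⊥-elim (¬2∣1 odd)
digon-parity false false true  true  _   odd = ⊥-elim (¬2∣1 odd)
digon-parity false false false true  odd _   = ⊥-elim (¬2∣1 odd)
digon-parity true  true  true  false _   odd = ⊥-elim (¬2∣3 odd)
digon-parity true  true  false false odd _   = ⊥-elim (¬2∣1 odd)
digon-parity true  false true  false odd _   = ⊥-elim (¬2∣1 odd)
digon-parity true  false false false _   odd = ⊥-elim (¬2∣1 odd)

-- The edge r = uv becomes the edge old r = uα; the new vertices α, β are joined by αβ₁, αβ₂,
-- and βv is a new edge.  An edge set of the new graph is  z₀ ∷ z₁ ∷ z₂ ∷ Z  for βv, αβ₁, αβ₂.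
module Digon (G : Graph) (r : Fin (m G)) where

  pattern α      = zero
  pattern β      = suc zero
  pattern lift x = suc (suc x)
  pattern βv     = zero
  pattern αβ₁    = suc zero
  pattern αβ₂    = suc (suc zero)
  pattern old e  = suc (suc (suc e))

  end₁′ : Fin (3 + m G) → Fin (2 + n G)
  end₁′ βv      = β
  end₁′ αβ₁     = α
  end₁′ αβ₂     = α
  end₁′ (old e) = lift (end₁ G e)

  end₂′ : Fin (3 + m G) → Fin (2 + n G)
  end₂′ βv      = lift (end₂ G r)
  end₂′ αβ₁     = β
  end₂′ αβ₂     = β
  end₂′ (old e) = if does (e ≟ r) then α else lift (end₂ G e)

  G′ : Graph
  G′ = record { n = 2 + n G ; m = 3 + m G ; end₁ = end₁′ ; end₂ = end₂′ }

  old-injective : ∀ {e e′ : Fin (m G)} → _≡_ {A = Fin (m G′)} (old e) (old e′) → e ≡ e′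
  old-injective = suc-injective ∘ suc-injective ∘ suc-injective

  end₂′-r : end₂′ (old r) ≡ α
  end₂′-r = if-≟-yes {x = r} α (lift (end₂ G r)) refl

  end₂′-old : ∀ {e} → e ≢ r → end₂′ (old e) ≡ lift (end₂ G e)
  end₂′-old e≢r = if-≟-no α _ e≢r

  incidence-α : ∀ e → incidence G′ (old e) α ≡ ind (does (e ≟ r))
  incidence-α e with e ≟ r
  ... | yes _ = refl
  ... | no  _ = refl

  incidence-β : ∀ e → incidence G′ (old e) β ≡ 0
  incidence-β e with e ≟ r
  ... | yes _ = refl
  ... | no  _ = refl

  incidence-lift : ∀ e x → e ≢ r → incidence G′ (old e) (lift x) ≡ incidence G e x
  incidence-lift e x e≢r with e ≟ r
  ... | yes e≡r = ⊥-elim (e≢r e≡r)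
  ... | no  _   = refl

  incidence-lift-r : ∀ x → incidence G′ (old r) (lift x) ≡ ind (does (end₁ G r ≟ x)) + 0
  incidence-lift-r x with r ≟ r
  ... | yes _   = refl
  ... | no  r≢r = ⊥-elim (r≢r refl)

  deg-α : ∀ z₀ z₁ z₂ (Z : EdgeSet G) → deg G′ (z₀ ∷ z₁ ∷ z₂ ∷ Z) α ≡ ind z₁ + (ind z₂ + ind (lookup Z r))
  deg-α z₀ z₁ z₂ Z = cong₂ _+_ (select-0 z₀) (cong₂ _+_ (ind-select z₁) (cong₂ _+_ (ind-select z₂) rest))
    where
    rest : sumFin (m G) (λ e → select (lookup Z e) (incidence G′ (old e) α)) ≡ ind (lookup Z r)
    rest = trans (sumFin-single (m G) _ r (λ e e≢r → trans (cong (select (lookup Z e)) (trans (incidence-α e) (ind-≢ e≢r)))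
                                                          (select-0 (lookup Z e))))
                 (trans (cong (select (lookup Z r)) (trans (incidence-α r) (ind-≡ {x = r} refl))) (ind-select (lookup Z r)))

  deg-β : ∀ z₀ z₁ z₂ (Z : EdgeSet G) → deg G′ (z₀ ∷ z₁ ∷ z₂ ∷ Z) β ≡ ind z₀ + (ind z₁ + ind z₂)
  deg-β z₀ z₁ z₂ Z =
    cong₂ _+_ (ind-select z₀) (cong₂ _+_ (ind-select z₁) (trans (cong₂ _+_ (ind-select z₂) rest) (+-identityʳ _)))
    where
    rest : sumFin (m G) (λ e → select (lookup Z e) (incidence G′ (old e) β)) ≡ 0
    rest = sumFin-zero (m G) _ (λ e → trans (cong (select (lookup Z e)) (incidence-β e)) (select-0 (lookup Z e)))

  -- The incidence of r at v has moved to βv.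
  deg-lift : ∀ z₀ z₁ z₂ (Z : EdgeSet G) x → z₀ ≡ lookup Z r →
             deg G′ (z₀ ∷ z₁ ∷ z₂ ∷ Z) (lift x) ≡ deg G Z x
  deg-lift z₀ z₁ z₂ Z x refl rewrite select-0 z₁ | select-0 z₂ = from-update (lookup Z r) update
    where
    u = ind (does (end₁ G r ≟ x))
    v = ind (does (end₂ G r ≟ x))
    s = sumFin (m G) (λ e → select (lookup Z e) (incidence G′ (old e) (lift x)))
    update : s + select (lookup Z r) (u + v) ≡ deg G Z x + select (lookup Z r) (u + 0)
    update = subst (λ c → s + select (lookup Z r) (u + v) ≡ deg G Z x + select (lookup Z r) c) (incidence-lift-r x)
               (sumFin-update (m G) _ _ r (λ e e≢r → cong (select (lookup Z e)) (incidence-lift e x e≢r)))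
    from-update : ∀ b → s + select b (u + v) ≡ deg G Z x + select b (u + 0) → select b v + s ≡ deg G Z x
    from-update false eq = trans (sym (+-identityʳ _)) (trans eq (+-identityʳ _))
    from-update true  eq = cancel-middle s u v _ eq

  cubic′ : Cubic G → Cubic G′
  cubic′ cubic α        = trans (deg-α true true true Full) (cong (λ b → 1 + (1 + ind b)) ([]=⇒lookup (∈⊤ {x = r})))
  cubic′ cubic β        = deg-β true true true Full
  cubic′ cubic (lift x) = trans (deg-lift true true true Full x (sym ([]=⇒lookup (∈⊤ {x = r})))) (cubic x)

  restrict : EdgeSet G′ → EdgeSet G
  restrict (_ ∷ _ ∷ _ ∷ Z) = Z

  restrict-cycle : ∀ Z → IsCycle G′ Z → IsCycle G (restrict Z)
  restrict-cycle (z₀ ∷ z₁ ∷ z₂ ∷ Z) cycle x = subst (2 ∣_) (deg-lift z₀ z₁ z₂ Z x z₀≡zᵣ) (cycle (lift x))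
    where
    z₀≡zᵣ : z₀ ≡ lookup Z r
    z₀≡zᵣ = digon-parity z₀ z₁ z₂ (lookup Z r) (subst (2 ∣_) (deg-α z₀ z₁ z₂ Z) (cycle α))
                                               (subst (2 ∣_) (deg-β z₀ z₁ z₂ Z) (cycle β))

  withDigon : EdgeSet G → EdgeSet G′
  withDigon C = false ∷ true ∷ true ∷ C

  withDigon-cycle : ∀ C → IsCycle G C → r ∉ C → IsCycle G′ (withDigon C)
  withDigon-cycle C cycle r∉C α =
    subst (2 ∣_) (sym (trans (deg-α false true true C) (cong (λ b → 1 + (1 + ind b)) (∉⇒lookup r∉C)))) (divides 1 refl)
  withDigon-cycle C cycle r∉C β        = subst (2 ∣_) (sym (deg-β false true true C)) (divides 1 refl)
  withDigon-cycle C cycle r∉C (lift x) = subst (2 ∣_) (sym (deg-lift false true true C x (sym (∉⇒lookup r∉C)))) (cycle x)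

  module _ {F′ : EdgeSet G′} where
    old-path : ∀ {e} → e ≢ r → old e ∈ F′ → Reach G′ F′ (lift (end₁ G e)) (lift (end₂ G e))
    old-path {e} e≢r p = step₁ (old e) p (subst (λ z → Reach G′ F′ z (lift (end₂ G e))) (sym (end₂′-old e≢r)) here)

    β-v : βv ∈ F′ → Reach G′ F′ β (lift (end₂ G r))
    β-v p = step₁ βv p here

    α-u : old r ∈ F′ → Reach G′ F′ α (lift (end₁ G r))
    α-u p = subst (λ z → Reach G′ F′ z (lift (end₁ G r))) end₂′-r (step₂ (old r) p here)

    r-path : old r ∈ F′ → αβ₁ ∈ F′ ⊎ αβ₂ ∈ F′ → βv ∈ F′ →
             Reach G′ F′ (lift (end₁ G r)) (lift (end₂ G r))
    r-path p (inj₁ q) p₀ = Reach-trans (Reach-sym (α-u p)) (step₁ αβ₁ q (β-v p₀))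
    r-path p (inj₂ q) p₀ = Reach-trans (Reach-sym (α-u p)) (step₁ αβ₂ q (β-v p₀))

    lift-edge : ∀ {F : EdgeSet G} → (∀ {e} → e ∈ F → old e ∈ F′) → αβ₁ ∈ F′ ⊎ αβ₂ ∈ F′ → βv ∈ F′ →
                ∀ {e} → e ∈ F → Reach G′ F′ (lift (end₁ G e)) (lift (end₂ G e))
    lift-edge old∈ digon βv∈ {e} e∈F with e ≟ r
    ... | yes refl = r-path (old∈ e∈F) digon βv∈
    ... | no  e≢r  = old-path e≢r (old∈ e∈F)

    module _ (F : EdgeSet G) (path : ∀ {e} → e ∈ F → Reach G′ F′ (lift (end₁ G e)) (lift (end₂ G e))) where
      lift-reach : ∀ {x y} → Reach G F x y → Reach G′ F′ (lift x) (lift y)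
      lift-reach here          = here
      lift-reach (step₁ e p q) = Reach-trans (path p) (lift-reach q)
      lift-reach (step₂ e p q) = Reach-trans (Reach-sym (path p)) (lift-reach q)

      lift-connected : Connected G F → (∃ λ x → Reach G′ F′ α (lift x)) → (∃ λ x → Reach G′ F′ β (lift x)) →
                       Connected G′ F′
      lift-connected connected α↝ β↝ x′ y′ with to-lift x′ | to-lift y′
        where
        to-lift : ∀ x′ → ∃ λ x → Reach G′ F′ x′ (lift x)
        to-lift α        = α↝
        to-lift β        = β↝
        to-lift (lift x) = x , here
      ... | x , x′↝x | y , y′↝y = Reach-trans x′↝x (Reach-trans (lift-reach (connected x y)) (Reach-sym y′↝y))

  without : TwoEdgeConnected G → ∀ e′ → Connected G′ (∁ ⁅ e′ ⁆)
  without (_ , bridgeless) βv =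
    lift-connected (∁ ⁅ r ⁆) (λ e∈ → old-path (∈∁⁅⁆⁻ e∈) (∈∁⁅⁆ βv λ ())) (bridgeless r)
      (_ , α-u (∈∁⁅⁆ βv λ ())) (_ , step₂ αβ₁ (∈∁⁅⁆ βv λ ()) (α-u (∈∁⁅⁆ βv λ ())))
  without (connected , _) αβ₁ =
    lift-connected Full (lift-edge (λ _ → ∈∁⁅⁆ αβ₁ λ ()) (inj₂ (∈∁⁅⁆ αβ₁ λ ())) (∈∁⁅⁆ αβ₁ λ ())) connected
      (_ , α-u (∈∁⁅⁆ αβ₁ λ ())) (_ , β-v (∈∁⁅⁆ αβ₁ λ ()))
  without (connected , _) αβ₂ =
    lift-connected Full (lift-edge (λ _ → ∈∁⁅⁆ αβ₂ λ ()) (inj₁ (∈∁⁅⁆ αβ₂ λ ())) (∈∁⁅⁆ αβ₂ λ ())) connected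
      (_ , α-u (∈∁⁅⁆ αβ₂ λ ())) (_ , β-v (∈∁⁅⁆ αβ₂ λ ()))
  without (_ , bridgeless) (old e₀) with e₀ ≟ r
  ... | yes refl =
    lift-connected (∁ ⁅ r ⁆) (λ e∈ → old-path (∈∁⁅⁆⁻ e∈) (∈∁⁅⁆ (old r) (∈∁⁅⁆⁻ e∈ ∘ old-injective)))
      (bridgeless r)
      (_ , step₁ αβ₁ (∈∁⁅⁆ (old r) λ ()) (β-v (∈∁⁅⁆ (old r) λ ()))) (_ , β-v (∈∁⁅⁆ (old r) λ ()))
  ... | no e₀≢r =
    lift-connected (∁ ⁅ e₀ ⁆)
      (lift-edge (λ e∈ → ∈∁⁅⁆ (old e₀) (∈∁⁅⁆⁻ e∈ ∘ old-injective)) (inj₁ (∈∁⁅⁆ (old e₀) λ ()))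
                 (∈∁⁅⁆ (old e₀) λ ()))
      (bridgeless e₀)
      (_ , α-u (∈∁⁅⁆ (old e₀) (e₀≢r ∘ sym ∘ old-injective))) (_ , β-v (∈∁⁅⁆ (old e₀) λ ()))

  twoEdgeConnected′ : TwoEdgeConnected G → TwoEdgeConnected G′
  twoEdgeConnected′ 2ec = (λ x y → Reach-mono (λ _ → ∈⊤) (without 2ec αβ₁ x y)) , without 2ec

  module _ (P : RankedTree G Full) (r∉T : r ∉ RankedTree.edges P) where
    open RankedTree P

    edges′ : EdgeSet G′
    edges′ = true ∷ false ∷ false ∷ (edges ∪ ⁅ r ⁆)

    rank′ : Fin (n G′) → ℕ
    rank′ α        = suc (rank (end₁ G r))
    rank′ β        = suc (rank (end₂ G r))
    rank′ (lift x) = rank x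

    child′ : Fin (m G′) → Fin (n G′)
    child′ βv      = β
    child′ αβ₁     = α
    child′ αβ₂     = α
    child′ (old e) = if does (e ≟ r) then α else lift (child e)

    ≢r : ∀ {e} → e ∈ edges → e ≢ r
    ≢r e∈T refl = r∉T e∈T

    child′-old : ∀ {e} → e ≢ r → child′ (old e) ≡ lift (child e)
    child′-old e≢r = if-≟-no α _ e≢r

    rank′<bound : ∀ x → rank′ x < suc bound
    rank′<bound α        = s≤s (rank<bound _)
    rank′<bound β        = s≤s (rank<bound _)
    rank′<bound (lift x) = m≤n⇒m≤1+n (rank<bound x)

    childEnd′ : ∀ {e} → e ∈ edges′ → ChildEnd G′ rank′ e (child′ e)
    childEnd′ {βv} _ = inj₁ (refl , ≤-refl)
    childEnd′ {old e} (there (there (there e∈T′))) with e ≟ r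
    ... | yes refl = inj₂ (refl , ≤-refl)
    ... | no  e≢r with ∈-∪⁅⁆⁻ edges r e∈T′
    ...   | inj₂ e≡r = ⊥-elim (e≢r e≡r)
    ...   | inj₁ e∈T with childEnd e∈T
    ...     | inj₁ (eq , lt) = inj₁ (cong lift eq , lt)
    ...     | inj₂ (eq , lt) = inj₂ (cong lift eq , lt)

    old-child : ∀ {e} → e ∈ edges ∪ ⁅ r ⁆ →
                (e ≡ r × child′ (old e) ≡ α) ⊎ (e ∈ edges × child′ (old e) ≡ lift (child e))
    old-child e∈T′ with ∈-∪⁅⁆⁻ edges r e∈T′
    ... | inj₂ refl = inj₁ (refl , if-≟-yes {x = r} α _ refl)
    ... | inj₁ e∈T  = inj₂ (e∈T , child′-old (≢r e∈T))

    old-child≢β : ∀ {e} → e ∈ edges ∪ ⁅ r ⁆ → child′ (old e) ≢ β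
    old-child≢β e∈T′ eq with old-child e∈T′
    ... | inj₁ (_ , c) with trans (sym c) eq
    ...   | ()
    old-child≢β e∈T′ eq | inj₂ (_ , c) with trans (sym c) eq
    ...   | ()

    child′-injective : ∀ {e e′} → e ∈ edges′ → e′ ∈ edges′ → child′ e ≡ child′ e′ → e ≡ e′
    child′-injective {βv} {βv} _ _ _ = refl
    child′-injective {βv} {old _} _ (there (there (there e′∈T′))) eq = ⊥-elim (old-child≢β e′∈T′ (sym eq))
    child′-injective {old _} {βv} (there (there (there e∈T′))) _ eq = ⊥-elim (old-child≢β e∈T′ eq)
    child′-injective {old e} {old e′} (there (there (there e∈T′))) (there (there (there e′∈T′))) eq
      with old-child e∈T′ | old-child e′∈T′
    ... | inj₁ (refl , _) | inj₁ (refl , _) = refl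
    ... | inj₁ (_ , c) | inj₂ (_ , c′) with trans (sym c) (trans eq c′)
    ...   | ()
    child′-injective _ _ eq | inj₂ (_ , c) | inj₁ (_ , c′) with trans (sym c) (trans eq c′)
    ...   | ()
    child′-injective _ _ eq | inj₂ (e∈T , c) | inj₂ (e′∈T , c′) =
      cong (λ e → old e) (child-injective e∈T e′∈T (suc-injective (suc-injective (trans (sym c) (trans eq c′)))))

    parent′ : ∀ {x} → x ∈ Full → x ≢ lift root → ∃ λ e → e ∈ edges′ × child′ e ≡ x
    parent′ {α} _ _ = old r , there (there (there (∈-∪⁅⁆ʳ r))) , if-≟-yes {x = r} α _ refl
    parent′ {β} _ _ = βv , here , refl
    parent′ {lift x} _ x≢root with parent ∈⊤ (x≢root ∘ cong lift)
    ... | e , e∈T , refl = old e , there (there (there (∈-∪⁅⁆ˡ e∈T))) , child′-old (≢r e∈T)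

    tree′ : RankedTree G′ Full
    tree′ = record
      { root = lift root ; root∈ = ∈⊤ ; edges = edges′ ; rank = rank′ ; bound = suc bound
      ; rank<bound = rank′<bound ; child = child′ ; childEnd = childEnd′ ; child-injective = child′-injective
      ; parent = parent′ ; ends∈ = λ _ → ∈⊤ , ∈⊤ }

    module _ {C : EdgeSet G} (r∉C : r ∉ C) where
      tree′-avoids : (∀ {e} → e ∈ edges → e ∉ C) → ∀ {e} → e ∈ edges′ → e ∉ withDigon C
      tree′-avoids T∩C=∅ {βv} _ ()
      tree′-avoids T∩C=∅ {old e} (there (there (there e∈T′))) (there (there (there e∈C)))
        with ∈-∪⁅⁆⁻ edges r e∈T′
      ... | inj₁ e∈T = T∩C=∅ e∈T e∈C
      ... | inj₂ refl = r∉C e∈C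

      cotree-shrinks : ∣ ∁ (withDigon C ∪ edges′) ∣ < ∣ ∁ (C ∪ edges) ∣
      cotree-shrinks = p⊂q⇒∣p∣<∣q∣ (p⊂q⇒∁p⊃∁q (grows , r , x∈p∪q⁺ (inj₂ (∈-∪⁅⁆ʳ r)) , r∉C∪T))
        where
        grows : C ∪ edges ⊆ C ∪ (edges ∪ ⁅ r ⁆)
        grows e∈ with x∈p∪q⁻ C edges e∈
        ... | inj₁ e∈C = x∈p∪q⁺ (inj₁ e∈C)
        ... | inj₂ e∈T = x∈p∪q⁺ (inj₂ (∈-∪⁅⁆ˡ e∈T))
        r∉C∪T : r ∉ C ∪ edges
        r∉C∪T r∈ with x∈p∪q⁻ C edges r∈
        ... | inj₁ r∈C = r∉C r∈C
        ... | inj₂ r∈T = r∉T r∈T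

  restrict-count : ∀ e (S : List (EdgeSet G′)) → count {G} e (map restrict S) ≡ count {G′} (old e) S
  restrict-count e []                      = refl
  restrict-count e ((_ ∷ _ ∷ _ ∷ Z) ∷ S) = cong (ind (lookup Z e) +_) (restrict-count e S)

  restrict-multiCDC : ∀ C → HasMultiCDCContaining G′ (withDigon C) → HasMultiCDCContaining G C
  restrict-multiCDC C (S , (cycles , twice) , C′∈S) =
    map restrict S , (cycles′ , λ e → trans (restrict-count e S) (twice (old e))) , ∈-map⁺ restrict C′∈S
    where
    cycles′ : ∀ D → D ∈ˡ map restrict S → IsCycle G D
    cycles′ D D∈ with ∈-map⁻ restrict D∈
    ... | Z , Z∈S , refl = restrict-cycle Z (cycles Z Z∈S)

-- Merging repeated cycles

count-↭ : ∀ {G} e {S S′ : List (EdgeSet G)} → S ↭ S′ → count {G} e S ≡ count {G} e S′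
count-↭ e Perm.refl        = refl
count-↭ e (prep D p)       = cong (ind (lookup D e) +_) (count-↭ e p)
count-↭ {G} e (swap D D′ p) =
  trans (x∙yz≈y∙xz (ind (lookup D e)) (ind (lookup D′ e)) _)
        (cong (λ c → ind (lookup D′ e) + (ind (lookup D e) + c)) (count-↭ {G} e p))
count-↭ e (Perm.trans p q) = trans (count-↭ e p) (count-↭ e q)

IsMultiCDC-↭ : ∀ {G} {S S′ : List (EdgeSet G)} → S ↭ S′ → IsMultiCDC G S → IsMultiCDC G S′
IsMultiCDC-↭ S↭S′ (cycles , twice) =
  (λ D D∈S′ → cycles D (∈-resp-↭ (Perm.↭-sym S↭S′) D∈S′)) , (λ e → trans (sym (count-↭ e S↭S′)) (twice e))

count≤length : ∀ {G} e (S : List (EdgeSet G)) → count {G} e S ≤ length S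
count≤length e []      = z≤n
count≤length e (D ∷ S) = +-mono-≤ (ind≤1 (lookup D e)) (count≤length e S)
  where
  ind≤1 : ∀ b → ind b ≤ 1
  ind≤1 true  = s≤s z≤n
  ind≤1 false = z≤n

unique-or-repeat : ∀ {k} (S : List (Subset k)) → Unique S ⊎ ∃₂ λ Y S′ → S ↭ Y ∷ Y ∷ S′
unique-or-repeat []      = inj₁ []
unique-or-repeat (Y ∷ S) with Any.any? (≡-dec Data.Bool._≟_ Y) S
... | yes Y∈S with ∈-∃++ Y∈S
...   | S₁ , S₂ , refl = inj₂ (Y , S₁ ++ S₂ , prep Y (shift Y S₁ S₂))
unique-or-repeat (Y ∷ S) | no Y∉S with unique-or-repeat S
... | inj₁ unique = inj₁ (¬Any⇒All¬ S Y∉S ∷ unique)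
... | inj₂ (Z , S′ , S↭) = inj₂ (Z , Y ∷ S′ , Perm.trans (prep Y S↭) (Perm.↭-sym (shift Y (Z ∷ Z ∷ []) S′)))

module _ {G : Graph} (cubic : Cubic G) {C : EdgeSet G} where

  Shorter : List (EdgeSet G) → Set
  Shorter S = ∃ λ S″ → IsMultiCDC G S″ × C ∈ˡ S″ × length S″ < length S

  drop-empty-repeat : ∀ {Y S′} → IsMultiCDC G (Y ∷ Y ∷ S′) → C ∈ˡ Y ∷ Y ∷ S′ → (∀ e → e ∉ Y) →
                      Shorter (Y ∷ Y ∷ S′)
  drop-empty-repeat {Y} {S′} (cycles , twice) C∈ Y=∅ =
    Y ∷ S′ , ((λ D D∈ → cycles D (Any.there D∈)) , twice′) , C∈′ C∈ , ≤-refl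
    where
    twice′ : ∀ e → count {G} e (Y ∷ S′) ≡ 2
    twice′ e = trans (cong (λ b → ind b + count {G} e S′) (∉⇒lookup (Y=∅ e)))
                     (trans (cong (λ b → ind b + (ind b + count {G} e S′)) (sym (∉⇒lookup (Y=∅ e)))) (twice e))
    C∈′ : C ∈ˡ Y ∷ Y ∷ S′ → C ∈ˡ Y ∷ S′
    C∈′ (Any.here C≡Y)     = Any.here C≡Y
    C∈′ (Any.there C∈Y∷S′) = C∈Y∷S′

  -- The two copies of Y already cover each edge of Y twice, so Y is disjoint from W.
  absorb : ∀ {Y W R} → IsMultiCDC G (Y ∷ Y ∷ W ∷ R) → (C ∈ˡ Y ∷ Y ∷ W ∷ R → C ∈ˡ Y ∷ (Y ∪ W) ∷ R) →
           C ∈ˡ Y ∷ Y ∷ W ∷ R → Shorter (Y ∷ Y ∷ W ∷ R)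
  absorb {Y} {W} {R} (cycles , twice) keep C∈ = Y ∷ (Y ∪ W) ∷ R , (cycles′ , twice′) , keep C∈ , ≤-refl
    where
    disjoint : ∀ e → lookup Y e ≡ true → lookup W e ≡ false
    disjoint e e∈Y with lookup W e in e∈W
    ... | false = refl
    ... | true with trans (cong₂ (λ y w → ind y + (ind y + (ind w + count {G} e R))) (sym e∈Y) (sym e∈W)) (twice e)
    ...   | ()
    cycles′ : ∀ D → D ∈ˡ Y ∷ (Y ∪ W) ∷ R → IsCycle G D
    cycles′ D (Any.here refl) = cycles Y (Any.here refl)
    cycles′ D (Any.there (Any.here refl)) x = subst (2 ∣_) (sym (deg-∪ G Y W x disjoint))
      (∣m∣n⇒∣m+n (cycles Y (Any.here refl) x) (cycles W (Any.there (Any.there (Any.here refl))) x))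
    cycles′ D (Any.there (Any.there D∈R)) = cycles D (Any.there (Any.there (Any.there D∈R)))
    twice′ : ∀ e → count {G} e (Y ∷ (Y ∪ W) ∷ R) ≡ 2
    twice′ e = trans (cong (λ c → ind (lookup Y e) + (c + count {G} e R))
                           (trans (cong ind (lookup-∪ Y W e)) (ind-∨ _ _ (disjoint e))))
                     (trans (cong (ind (lookup Y e) +_) (+-assoc (ind (lookup Y e)) _ _)) (twice e))

  Shorter-↭ : ∀ {S S′} → S ↭ S′ → Shorter S′ → Shorter S
  Shorter-↭ S↭S′ (S″ , cdc , C∈S″ , lt) = S″ , cdc , C∈S″ , subst (length S″ <_) (sym (↭-length S↭S′)) lt

  absorb-one-of-two : ∀ {Y} S′ → IsMultiCDC G (Y ∷ Y ∷ S′) → C ∈ˡ Y ∷ Y ∷ S′ → 2 ≤ length S′ →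
                      Shorter (Y ∷ Y ∷ S′)
  absorb-one-of-two (_ ∷ []) _ _ (s≤s ())
  absorb-one-of-two {Y} (W₁ ∷ W₂ ∷ R) cdc C∈ _ with ≡-dec Data.Bool._≟_ W₁ C
  ... | yes refl =
    Shorter-↭ reorder (absorb (IsMultiCDC-↭ reorder cdc) (λ _ → Any.there (Any.there (Any.here refl)))
                              (∈-resp-↭ reorder C∈))
    where
    reorder : Y ∷ Y ∷ W₁ ∷ W₂ ∷ R ↭ Y ∷ Y ∷ W₂ ∷ W₁ ∷ R
    reorder = prep Y (prep Y (swap W₁ W₂ Perm.refl))
  ... | no W₁≢C = absorb cdc keep C∈
    where
    keep : C ∈ˡ Y ∷ Y ∷ W₁ ∷ W₂ ∷ R → C ∈ˡ Y ∷ (Y ∪ W₁) ∷ W₂ ∷ R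
    keep (Any.here C≡Y)                          = Any.here C≡Y
    keep (Any.there (Any.here C≡Y))              = Any.here C≡Y
    keep (Any.there (Any.there (Any.here C≡W₁))) = ⊥-elim (W₁≢C (sym C≡W₁))
    keep (Any.there (Any.there (Any.there C∈)))  = Any.there (Any.there C∈)

  -- A nonempty cycle Y of a cubic graph misses an edge f, which lies on two further members.
  merge-repeat : ∀ {Y} S′ → IsMultiCDC G (Y ∷ Y ∷ S′) → C ∈ˡ Y ∷ Y ∷ S′ → Shorter (Y ∷ Y ∷ S′)
  merge-repeat {Y} S′ cdc@(cycles , twice) C∈ with nonempty? Y
  ... | no Y=∅ = drop-empty-repeat cdc C∈ (λ e e∈Y → Y=∅ (e , e∈Y))
  ... | yes (e₀ , _) with cubic-∁cycle-incident G cubic Y (cycles Y (Any.here refl)) (end₁ G e₀)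
  ...   | f , f∉Y , _ = absorb-one-of-two S′ cdc C∈ (subst (_≤ length S′) f-twice (count≤length f S′))
    where
    f-twice : count {G} f S′ ≡ 2
    f-twice = trans (cong (λ b → ind b + (ind b + count {G} f S′)) (sym (∉⇒lookup f∉Y))) (twice f)

  multiCDC⇒CDC : HasMultiCDCContaining G C → HasCDCContaining G C
  multiCDC⇒CDC (S , cdc , C∈S) = deduplicate (suc (length S)) S ≤-refl cdc C∈S
    where
    deduplicate : ∀ k S → length S < k → IsMultiCDC G S → C ∈ˡ S → HasCDCContaining G C
    deduplicate (suc k) S lt cdc@(cycles , twice) C∈S with unique-or-repeat S
    ... | inj₁ unique = S , (unique , cycles , twice) , C∈S
    ... | inj₂ (Y , S′ , S↭)
      with Shorter-↭ S↭ (merge-repeat S′ (IsMultiCDC-↭ S↭ cdc) (∈-resp-↭ S↭ C∈S))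
    ...   | S″ , cdc″ , C∈S″ , shorter = deduplicate k S″ (<-≤-trans shorter (≤-pred lt)) cdc″ C∈S″

-- (B) ⇒ (A)

CDC⇒multiCDC : ∀ {G C} → HasCDCContaining G C → HasMultiCDCContaining G C
CDC⇒multiCDC (S , (_ , cycles , twice) , C∈S) = S , (cycles , twice) , C∈S

tree-cycle-decomposition : ∀ {G C} (P : RankedTree G Full) → IsCycle G C →
                           (∀ {e} → e ∈ RankedTree.edges P → e ∉ C) →
                           (∀ e → e ∉ ∁ (C ∪ RankedTree.edges P)) →
                           TreeCycleDecomposition G Full (RankedTree.edges P) C
tree-cycle-decomposition {G} {C} P cycle T∩C=∅ no-cotree =
  rankedTree-isTree P , cycle , (λ e (e∈T , e∈C) → T∩C=∅ e∈T e∈C) , cover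
  where
  cover : ∀ e → e ∈ RankedTree.edges P ⊎ e ∈ C
  cover e with x∈p∪q⁻ C (RankedTree.edges P) (x∉∁p⇒x∈p (no-cotree e))
  ... | inj₁ e∈C = inj₂ e∈C
  ... | inj₂ e∈T = inj₁ e∈T

reduce : StatementB → ∀ k G → TwoEdgeConnected G → Cubic G → ∀ {C} → IsCycle G C → (P : RankedTree G Full) →
         (∀ {e} → e ∈ RankedTree.edges P → e ∉ C) → ∣ ∁ (C ∪ RankedTree.edges P) ∣ < k →
         HasMultiCDCContaining G C
reduce hB (suc k) G 2ec cubic {C} cycle P T∩C=∅ lt with nonempty? (∁ (C ∪ RankedTree.edges P))
... | no no-cotree =
  CDC⇒multiCDC (hB G 2ec cubic Full _ C (tree-cycle-decomposition P cycle T∩C=∅ (λ e e∈ → no-cotree (e , e∈))))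
... | yes (r , r∈cotree) =
  restrict-multiCDC C
    (reduce hB k G′ (twoEdgeConnected′ 2ec) (cubic′ cubic) (withDigon-cycle C cycle r∉C)
            (tree′ P r∉T) (tree′-avoids P r∉T r∉C T∩C=∅) (<-≤-trans (cotree-shrinks P r∉T r∉C) (≤-pred lt)))
  where
  open Digon G r
  r∉C : r ∉ C
  r∉C r∈C = x∈∁p⇒x∉p r∈cotree (x∈p∪q⁺ (inj₁ r∈C))
  r∉T : r ∉ RankedTree.edges P
  r∉T r∈T = x∈∁p⇒x∉p r∈cotree (x∈p∪q⁺ (inj₂ r∈T))

vertex-or-edgeless : ∀ G → Fin (n G) ⊎ ¬ Fin (m G)
vertex-or-edgeless G = go (n G) (end₁ G)
  where
  go : ∀ k → (Fin (m G) → Fin k) → Fin k ⊎ ¬ Fin (m G)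
  go zero    end = inj₂ λ e → case end e of λ ()
  go (suc k) end = inj₁ zero

edgeless-CDC : ∀ {G C} → ¬ Fin (m G) → IsCycle G C → HasCDCContaining G C
edgeless-CDC {C = C} edgeless cycle =
  C ∷ [] , ([] ∷ [] , (λ { D (Any.here refl) → cycle }) , ⊥-elim ∘ edgeless) , Any.here refl

B⇒A : StatementB → StatementA
B⇒A hB G 2ec cubic C cycle nonSeparating with vertex-or-edgeless G
... | inj₂ edgeless = edgeless-CDC edgeless cycle
... | inj₁ root with spanning-tree nonSeparating root
...   | P , T⊆∁C = multiCDC⇒CDC cubic
                     (reduce hB _ G 2ec cubic cycle P (λ e∈T → x∈∁p⇒x∉p (T⊆∁C e∈T)) ≤-refl)

proposition1p4 : StatementA ⇔ StatementB
proposition1p4 = mk⇔ A⇒B B⇒A
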